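{- Let $C$ be a dendritic face complex. Then for every $k$, the relation $<^+$ on $C_k$ is a strict partial order (in particular there is no $a\in C_k$ with $a<^+a$).
   Context: A positive-to-one poset (POP) is a finite set $P$ with $\dim:P\to\mathbb{N}$ and binary relations $\prec^-,\prec^+$; $y\prec x$ means $y\prec^-x$ or $y\prec^+x$. Axioms: $y\prec x\Rightarrow\dim x=\dim y+1$; never both $y\prec^-x$ and $y\prec^+x$; every $x$ with $\dim x\ge1$ has exactly one $y$ with $y\prec^+x$, denoted $\gamma(x)$, and at least one $y$ with $y\prec^-x$. $\delta(x)=\{y:y\prec^-x\}$, $C_k=\dim^{ -1}(k)$; $\le$ is the reflexive-transitive closure of $\prec$. A dendritic face complex is a POP such that: it has a greatest element for $\le$; (oriented thinness) whenever $z\prec^{\beta}y\prec^{\alpha}x$ there is a unique $y'\ne y$ with $z\prec y'\prec x$, and writing $z\prec^{\beta'}y'\prec^{\alpha'}x$ the signs (as $\pm1$) satisfy $\alpha\beta=-\alpha'\beta'$; (acyclicity) $\delta(x)$ is a singleton if $\dim x=1$, nonempty if $\dim x\ge1$, and for $\dim x\ge1$ there are no $p\ge1$, $y_1,\dots,y_p\in\delta(x)$ with $\gamma(y_{i+1})\in\delta(y_i)$ ($1\le i<p$) and $\gamma(y_1)\in\delta(y_p)$. For $a,b\in C_k$, $a\triangleleft^+b$ iff there is $c\in C_{k+1}$ with $a\prec^-c$ and $b=\gamma(c)$; $<^+$ is the transitive closure of $\triangleleft^+$. -}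

module Defs where

open import Data.Nat using (ℕ; zero; suc; _≥_; _+_)
open import Data.Fin using (Fin; zero; suc; inject₁; fromℕ)
open import Data.Product using (Σ; ∃; _×_; _,_; proj₁)
open import Data.Sum using (_⊎_)
open import Relation.Binary.PropositionalEquality using (_≡_; _≢_)
open import Relation.Nullary using (¬_)
open import Data.Empty using (⊥)
open import Relation.Binary.Construct.Closure.ReflexiveTransitive using (Star)
open import Relation.Binary.Construct.Closure.Transitive using (TransClosure)
open import Relation.Binary.Structures using (IsStrictPartialOrder)

data Sign : Set where
  plus minus : Sign

_·_ : Sign → Sign → Sign
plus  · s = s
minus · plus = minus
minus · minus = plus

neg : Sign → Sign
neg plus = minus
neg minus = plus

record POP (n : ℕ) : Set₁ where
  field
    dim  : Fin n → ℕ
    _≺⁻_ : Fin n → Fin n → Set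
    _≺⁺_ : Fin n → Fin n → Set
    ≺⁻-dim  : ∀ {y x} → y ≺⁻ x → dim x ≡ suc (dim y)
    ≺⁺-dim  : ∀ {y x} → y ≺⁺ x → dim x ≡ suc (dim y)
    not-both : ∀ {y x} → y ≺⁻ x → y ≺⁺ x → ⊥
    γ-exists : ∀ x → dim x ≥ 1 → ∃ λ y → y ≺⁺ x
    γ-unique : ∀ {x y y'} → y ≺⁺ x → y' ≺⁺ x → y ≡ y'
    δ-nonempty : ∀ x → dim x ≥ 1 → ∃ λ y → y ≺⁻ x

  _≺[_]_ : Fin n → Sign → Fin n → Set
  y ≺[ plus ] x = y ≺⁺ x
  y ≺[ minus ] x = y ≺⁻ x

  _≺_ : Fin n → Fin n → Set
  y ≺ x = (y ≺⁻ x) ⊎ (y ≺⁺ x)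

  _≤_ : Fin n → Fin n → Set
  _≤_ = Star _≺_

  -- "γ(w) ∈ δ(y)", written without the partial function γ:
  -- some (equivalently: the unique) w' with w' ≺⁺ w satisfies w' ≺⁻ y.
  γ∈δ : Fin n → Fin n → Set
  γ∈δ w y = ∃ λ w' → (w' ≺⁺ w) × (w' ≺⁻ y)

  C : ℕ → Set
  C k = Σ (Fin n) λ x → dim x ≡ k

  _◁⁺_ : ∀ {k} → C k → C k → Set
  _◁⁺_ {k} a b = ∃ λ c → (dim c ≡ suc k) × (proj₁ a ≺⁻ c) × (proj₁ b ≺⁺ c)

  _<⁺_ : ∀ {k} → C k → C k → Set
  _<⁺_ = TransClosure _◁⁺_

record IsDendriticFaceComplex {n : ℕ} (P : POP n) : Set where
  open POP P
  field
    greatest : ∃ λ t → ∀ x → x ≤ t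
    oriented-thin :
      ∀ {x y z α β} → z ≺[ β ] y → y ≺[ α ] x →
      ∃ λ y' → (y' ≢ y)
        × (∃ λ β' → ∃ λ α' → (z ≺[ β' ] y') × (y' ≺[ α' ] x) × (α · β ≡ neg (α' · β')))
        × (∀ y'' → y'' ≢ y → z ≺ y'' → y'' ≺ x → y'' ≡ y')
    δ-singleton : ∀ x → dim x ≡ 1 → ∃ λ y → (y ≺⁻ x) × (∀ y' → y' ≺⁻ x → y' ≡ y)
    acyclic : ∀ x → dim x ≥ 1 → ∀ (p : ℕ) (ys : Fin (suc p) → Fin n) →
      (∀ i → ys i ≺⁻ x) →
      (∀ (i : Fin p) → γ∈δ (ys (suc i)) (ys (inject₁ i))) →
      γ∈δ (ys zero) (ys (fromℕ p)) → ⊥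

{-# OPTIONS --safe #-}

-- Write a ◁[ x ] b when a ◁⁺ b is witnessed by a (k+1)-cell below x. As C has a greatest
-- element, it suffices to show that ◁[ x ] has no cycles, by induction on the codimension d
-- of the (k+1)-cells in x.
-- For d ≤ 1 every witness is x or a face of x. Rotating a cycle a₀ ◁ a₁ ◁ ⋯ ◁ a₀ with
-- witnesses c₀, c₁, … gives a cycle of cells with γ(cᵢ) ∈ δ(cᵢ₊₁): for d = 0 this says
-- γ(x) ∈ δ(x), and for d = 1 oriented thinness keeps γ(x) out of it, so it is a cycle in δ(x),
-- contradicting acyclicity.
-- For d ≥ 2 every step witnessed below x becomes a chain of steps witnessed below γ(x).
-- A witness below an input face y of x is either γ(y) or below an input face e of y; by
-- thinness e lies below γ(x) or is the output of an input face y' of x with y' feeding y.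
-- A step a ◁ γ(γ(y)) through γ(y) is replaced by a path from a to γ(γ(y)) through input
-- faces of y. Both recursions are well-founded since δ(x) and δ(y) are finite and acyclic.

module Submission where

open import Defs
open import Level using (Level)
open import Data.Nat using (ℕ; zero; suc; _+_; _∸_; _<_; s≤s; z≤n)
import Data.Nat as ℕ
open import Data.Nat.Properties using (suc-injective; ≤-refl; ≤-trans; <⇒≤; <-irrefl; <-trans; <-≤-trans; m≤n+m; m∸n+n≡m; n<1+n)
open import Data.Fin using (Fin; zero; suc; inject₁; fromℕ)
open import Data.Fin.Induction using (spo-wellFounded; spo-noetherian)
open import Data.Product using (∃; ∃₂; _×_; _,_; proj₁; proj₂)
open import Data.Sum using (_⊎_; inj₁; inj₂; [_,_]′)
open import Data.Empty using (⊥; ⊥-elim)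
open import Function using (id; flip)
open import Induction.WellFounded using (Acc; acc; WellFounded; module Subrelation)
open import Relation.Nullary using (¬_)
open import Relation.Binary.Core using (Rel; REL; _⇒_; _=[_]⇒_)
open import Relation.Binary.Structures using (IsStrictPartialOrder)
open import Relation.Binary.PropositionalEquality
  using (_≡_; refl; sym; trans; cong; subst; resp₂; isEquivalence)
open import Relation.Binary.Construct.Closure.ReflexiveTransitive using (Star; ε; _◅_; _◅◅_; reverse)
open import Relation.Binary.Construct.Closure.Transitive using (TransClosure; [_]; _∷_; _++_)

private
  variable
    a b ℓ ℓ₁ ℓ₂ : Level
    A : Set a
    B : Set b

module _ {R : Rel A ℓ₁} where

  head⁺ : ∀ {x y} → TransClosure R x y → ∃ (R x)
  head⁺ [ r ]   = _ , r
  head⁺ (r ∷ _) = _ , r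

  _◅⁺_ : ∀ {x y z} → R x y → Star R y z → TransClosure R x z
  r ◅⁺ ε         = [ r ]
  r ◅⁺ (s ◅ rs) = r ∷ (s ◅⁺ rs)

  ⁺⇒* : ∀ {x y} → TransClosure R x y → Star R x y
  ⁺⇒* [ r ]    = r ◅ ε
  ⁺⇒* (r ∷ rs) = r ◅ ⁺⇒* rs

  uncons⁺ : ∀ {x y} → TransClosure R x y → ∃ λ z → R x z × Star R z y
  uncons⁺ [ r ]    = _ , r , ε
  uncons⁺ (r ∷ rs) = _ , r , ⁺⇒* rs

  acyclic⇒isStrictPartialOrder : (∀ {x} → ¬ TransClosure R x x) →
                                 IsStrictPartialOrder _≡_ (TransClosure R)
  acyclic⇒isStrictPartialOrder acyclic = record
    { isEquivalence = isEquivalence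
    ; irrefl        = λ { refl → acyclic }
    ; trans         = _++_
    ; <-resp-≈      = resp₂ _
    }

module _ {S : Rel B ℓ₂} {f : A → B} {R : Rel A ℓ₁} where

  map⁺ : R =[ f ]⇒ S → TransClosure R =[ f ]⇒ TransClosure S
  map⁺ g [ r ]    = [ g r ]
  map⁺ g (r ∷ rs) = g r ∷ map⁺ g rs

module _ {R : Rel A ℓ₁} {S : Rel A ℓ₂} where

  concatMap⁺ : R ⇒ TransClosure S → TransClosure R ⇒ TransClosure S
  concatMap⁺ g [ r ]    = g r
  concatMap⁺ g (r ∷ rs) = g r ++ concatMap⁺ g rs

module _ {L : REL A B ℓ₁} {R : REL B A ℓ₂} where

  private
    LR RL : Rel _ _
    LR x y = ∃ λ c → L x c × R c y
    RL c c' = ∃ λ y → R c y × L y c'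

    split⁺ : ∀ {x y} → TransClosure LR x y → ∃₂ λ c c' → L x c × Star RL c c' × R c' y
    split⁺ [ c , l , r ] = c , c , l , ε , r
    split⁺ ((c , l , r) ∷ rest) with split⁺ rest
    ... | c₁ , c' , l₁ , path , r' = c , c' , l , (_ , r , l₁) ◅ path , r'

  rotate⁺ : ∀ {x} → TransClosure (λ x y → ∃ λ c → L x c × R c y) x x →
            ∃ λ c → TransClosure (λ c c' → ∃ λ y → R c y × L y c') c c
  rotate⁺ cycle with split⁺ cycle
  ... | c , c' , l , path , r = c' , (_ , r , l) ◅⁺ path

module _ {R : Rel A ℓ} where

  steps : ∀ {x y} → Star R x y → ℕ
  steps ε        = 0
  steps (_ ◅ rs) = suc (steps rs)

  vertices : ∀ {x y} (rs : Star R x y) → Fin (suc (steps rs)) → A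
  vertices {x} _        zero    = x
  vertices (_ ◅ rs) (suc i) = vertices rs i

  vertices-last : ∀ {x y} (rs : Star R x y) → vertices rs (fromℕ (steps rs)) ≡ y
  vertices-last ε        = refl
  vertices-last (_ ◅ rs) = vertices-last rs

  vertices-step : ∀ {x y} (rs : Star R x y) (i : Fin (steps rs)) →
                  R (vertices rs (inject₁ i)) (vertices rs (suc i))
  vertices-step (r ◅ _)  zero    = r
  vertices-step (_ ◅ rs) (suc i) = vertices-step rs i

module _ {n : ℕ} {R : Rel (Fin n) ℓ} (acyclic : ∀ {x} → ¬ TransClosure R x x) where

  acyclic⇒wellFounded : WellFounded R
  acyclic⇒wellFounded =
    Subrelation.wellFounded [_] (spo-wellFounded (acyclic⇒isStrictPartialOrder acyclic))

  acyclic⇒noetherian : WellFounded (flip R)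
  acyclic⇒noetherian =
    Subrelation.wellFounded [_] (spo-noetherian (acyclic⇒isStrictPartialOrder acyclic))

module DendriticFaceComplex {n : ℕ} (P : POP n) (D : IsDendriticFaceComplex P) where
  open POP P
  open IsDendriticFaceComplex D

  ≺-dim : ∀ {y x} → y ≺ x → dim x ≡ suc (dim y)
  ≺-dim (inj₁ y≺⁻x) = ≺⁻-dim y≺⁻x
  ≺-dim (inj₂ y≺⁺x) = ≺⁺-dim y≺⁺x

  ≺-dim-pred : ∀ {y x m} → y ≺ x → dim x ≡ suc m → dim y ≡ m
  ≺-dim-pred y≺x dim-x = suc-injective (trans (sym (≺-dim y≺x)) dim-x)

  ≺-same-dim : ∀ {u v x} → u ≺ x → v ≺ x → dim u ≡ dim v
  ≺-same-dim u≺x v≺x = ≺-dim-pred u≺x (≺-dim v≺x)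

  ≺⁻⇒dim≥1 : ∀ {y x} → y ≺⁻ x → dim x ℕ.≥ 1
  ≺⁻⇒dim≥1 y≺⁻x = subst (1 ℕ.≤_) (sym (≺⁻-dim y≺⁻x)) (s≤s z≤n)

  ≺⇒dim< : ∀ {y x} → y ≺ x → dim y < dim x
  ≺⇒dim< {y} y≺x = subst (dim y <_) (sym (≺-dim y≺x)) (n<1+n (dim y))

  ≤-dim : ∀ {y x} → y ≤ x → dim y ℕ.≤ dim x
  ≤-dim ε           = ≤-refl
  ≤-dim (y≺m ◅ m≤x) = ≤-trans (<⇒≤ (≺⇒dim< y≺m)) (≤-dim m≤x)

  ≤∧dim≡⇒≡ : ∀ {y x} → y ≤ x → dim y ≡ dim x → y ≡ x
  ≤∧dim≡⇒≡ ε           _     = refl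
  ≤∧dim≡⇒≡ (y≺m ◅ m≤x) dim≡ = ⊥-elim (<-irrefl dim≡ (<-≤-trans (≺⇒dim< y≺m) (≤-dim m≤x)))

  ≤-≺-trans : ∀ {y m x} → y ≤ m → m ≺ x → y ≤ x
  ≤-≺-trans y≤m m≺x = y≤m ◅◅ (m≺x ◅ ε)

  ≤⇒≡⊎≤≺ : ∀ {y x} → y ≤ x → y ≡ x ⊎ ∃ λ m → y ≤ m × m ≺ x
  ≤⇒≡⊎≤≺ ε = inj₁ refl
  ≤⇒≡⊎≤≺ (y≺m ◅ m≤x) with ≤⇒≡⊎≤≺ m≤x
  ... | inj₁ refl              = inj₂ (_ , ε , y≺m)
  ... | inj₂ (m' , m≤m' , m'≺x) = inj₂ (m' , y≺m ◅ m≤m' , m'≺x)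

  ≤∧dim<⇒≤≺ : ∀ {y x} → y ≤ x → dim y < dim x → ∃ λ m → y ≤ m × m ≺ x
  ≤∧dim<⇒≤≺ y≤x dim< with ≤⇒≡⊎≤≺ y≤x
  ... | inj₁ refl = ⊥-elim (<-irrefl refl dim<)
  ... | inj₂ below = below

  ≤∧dim+1⇒≺ : ∀ {y x} → y ≤ x → dim x ≡ suc (dim y) → y ≺ x
  ≤∧dim+1⇒≺ {y} y≤x dim-x with ≤∧dim<⇒≤≺ y≤x (subst (dim y <_) (sym dim-x) (n<1+n (dim y)))
  ... | m , y≤m , m≺x with refl ← ≤∧dim≡⇒≡ y≤m (sym (≺-dim-pred m≺x dim-x)) = m≺x

  thin-out : ∀ {z y x β} → z ≺[ β ] y → y ≺⁺ x → ∃ λ y' → z ≺[ β ] y' × y' ≺⁻ x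
  thin-out {β = β} z≺y y≺⁺x with oriented-thin {α = plus} {β = β} z≺y y≺⁺x
  ... | y' , y'≢y , (_     , plus  , _    , y'≺⁺x , _)    , _ = ⊥-elim (y'≢y (γ-unique y'≺⁺x y≺⁺x))
  ... | y' , _    , (plus  , minus , z≺y' , y'≺⁻x , refl) , _ = y' , z≺y' , y'≺⁻x
  ... | y' , _    , (minus , minus , z≺y' , y'≺⁻x , refl) , _ = y' , z≺y' , y'≺⁻x

  thin-out≺ : ∀ {z y x} → z ≺ y → y ≺⁺ x → ∃ λ y' → z ≺ y' × y' ≺⁻ x
  thin-out≺ (inj₁ z≺⁻y) y≺⁺x with y' , z≺⁻y' , y'≺⁻x ← thin-out {β = minus} z≺⁻y y≺⁺x =
    y' , inj₁ z≺⁻y' , y'≺⁻x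
  thin-out≺ (inj₂ z≺⁺y) y≺⁺x with y' , z≺⁺y' , y'≺⁻x ← thin-out {β = plus} z≺⁺y y≺⁺x =
    y' , inj₂ z≺⁺y' , y'≺⁻x

  thin-in⁺ : ∀ {z y x} → z ≺⁺ y → y ≺⁻ x →
             (∃ λ y' → z ≺⁻ y' × y' ≺⁻ x) ⊎ (∃ λ y' → z ≺⁺ y' × y' ≺⁺ x)
  thin-in⁺ z≺y y≺x with oriented-thin {α = minus} {β = plus} z≺y y≺x
  ... | y' , _ , (minus , minus , z≺y' , y'≺x , _)  , _ = inj₁ (y' , z≺y' , y'≺x)
  ... | y' , _ , (plus  , plus  , z≺y' , y'≺x , _)  , _ = inj₂ (y' , z≺y' , y'≺x)
  ... | _  , _ , (plus  , minus , _    , _    , ()) , _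
  ... | _  , _ , (minus , plus  , _    , _    , ()) , _

  thin-in⁻ : ∀ {z y x} → z ≺⁻ y → y ≺⁻ x →
             (∃ λ y' → z ≺⁻ y' × y' ≺⁺ x) ⊎ (∃ λ y' → z ≺⁺ y' × y' ≺⁻ x)
  thin-in⁻ z≺y y≺x with oriented-thin {α = minus} {β = minus} z≺y y≺x
  ... | y' , _ , (minus , plus  , z≺y' , y'≺x , _)  , _ = inj₁ (y' , z≺y' , y'≺x)
  ... | y' , _ , (plus  , minus , z≺y' , y'≺x , _)  , _ = inj₂ (y' , z≺y' , y'≺x)
  ... | _  , _ , (plus  , plus  , _    , _    , ()) , _
  ... | _  , _ , (minus , minus , _    , _    , ()) , _

  γγ-not-in-δ-of-face : ∀ {z y x w} → z ≺⁺ y → y ≺⁺ x → z ≺⁻ w → w ≺ x → ⊥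
  γγ-not-in-δ-of-face z≺⁺y y≺⁺x z≺⁻w w≺x with oriented-thin {α = plus} {β = plus} z≺⁺y y≺⁺x
  ... | y' , y'≢y , (β' , α' , z≺y' , y'≺x , sign) , unique
    with refl ← unique _ (λ { refl → not-both z≺⁻w z≺⁺y }) (inj₁ z≺⁻w) w≺x
    with β' | α' | z≺y' | y'≺x | sign
  ... | plus  | _     | z≺⁺w | _    | _  = not-both z≺⁻w z≺⁺w
  ... | minus | plus  | _    | w≺⁺x | _  = y'≢y (γ-unique w≺⁺x y≺⁺x)
  ... | minus | minus | _    | _    | ()

  ≤-output⊎≤-input : ∀ {c y} → c ≤ y → dim c < dim y → c ≺⁺ y ⊎ ∃ λ d → d ≺⁻ y × c ≤ d
  ≤-output⊎≤-input c≤y dim< with ≤∧dim<⇒≤≺ c≤y dim<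
  ... | m , c≤m , inj₁ m≺⁻y = inj₂ (m , m≺⁻y , c≤m)
  ... | m , c≤m , inj₂ m≺⁺y with ≤⇒≡⊎≤≺ c≤m
  ...   | inj₁ refl                  = inj₁ m≺⁺y
  ...   | inj₂ (f , c≤f , f≺m) with thin-out≺ f≺m m≺⁺y
  ...     | d , f≺d , d≺⁻y = inj₂ (d , d≺⁻y , ≤-≺-trans c≤f f≺d)

  Feeds : Fin n → Rel (Fin n) _
  Feeds x u v = u ≺⁻ x × γ∈δ u v

  -- The acyclicity axiom lists a cycle backwards (γ(yᵢ₊₁) ∈ δ(yᵢ)), hence the reversal.
  Feeds-acyclic : ∀ x {u} → ¬ TransClosure (Feeds x) u u
  Feeds-acyclic x cycle with uncons⁺ cycle
  ... | v , (u≺⁻x , γu∈δv) , v⇀*u =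
    acyclic x (≺⁻⇒dim≥1 u≺⁻x) (steps back) ys inputs links
      (subst (γ∈δ _) (sym (vertices-last back)) γu∈δv)
    where
    back : Star (flip (Feeds x)) _ v
    back = reverse id v⇀*u
    ys : Fin (suc (steps back)) → Fin n
    ys = vertices back
    links : ∀ i → γ∈δ (ys (suc i)) (ys (inject₁ i))
    links i = proj₂ (vertices-step back i)
    inputs : ∀ i → ys i ≺⁻ x
    inputs zero    = u≺⁻x
    inputs (suc i) = proj₁ (vertices-step back i)

  Feeds-wellFounded : ∀ x → WellFounded (Feeds x)
  Feeds-wellFounded x = acyclic⇒wellFounded (Feeds-acyclic x)

  Feeds-noetherian : ∀ x → WellFounded (flip (Feeds x))
  Feeds-noetherian x = acyclic⇒noetherian (Feeds-acyclic x)

  Reduces : ∀ {ℓ} → Rel (Fin n) ℓ → Fin n → Set ℓ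
  Reduces R c = ∀ {a b} → a ≺⁻ c → b ≺⁺ c → TransClosure R a b

  reduces-output : ∀ {ℓ} {R : Rel (Fin n) ℓ} {y m} →
                   (∀ {d} → d ≺⁻ y → Reduces R d) → m ≺⁺ y → Reduces R m
  reduces-output {R = R} {y} inputs-reduce m≺⁺y {b = b} a≺⁻m b≺⁺m
    with d , a≺⁻d , d≺⁻y ← thin-out {β = minus} a≺⁻m m≺⁺y =
    walk (Feeds-noetherian y d) d≺⁻y a≺⁻d
    where
    walk : ∀ {d a} → Acc (flip (Feeds y)) d → d ≺⁻ y → a ≺⁻ d → TransClosure R a b
    walk {d} (acc later) d≺⁻y a≺⁻d with γ-exists d (≺⁻⇒dim≥1 a≺⁻d)
    ... | b' , b'≺⁺d with thin-in⁺ b'≺⁺d d≺⁻y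
    ...   | inj₁ (d' , b'≺⁻d' , d'≺⁻y) =
      inputs-reduce d≺⁻y a≺⁻d b'≺⁺d ++ walk (later (d≺⁻y , b' , b'≺⁺d , b'≺⁻d')) d'≺⁻y b'≺⁻d'
    ...   | inj₂ (e , b'≺⁺e , e≺⁺y)
      with refl ← γ-unique e≺⁺y m≺⁺y
      with refl ← γ-unique b'≺⁺e b≺⁺m = inputs-reduce d≺⁻y a≺⁻d b'≺⁺d

  module _ (k : ℕ) where

    _◁[_]_ : Fin n → Fin n → Fin n → Set
    a ◁[ x ] b = ∃ λ c → c ≤ x × dim c ≡ suc k × a ≺⁻ c × b ≺⁺ c

    ◁[]-acyclic-top : ∀ {x a} → dim x ≡ suc k → ¬ TransClosure (_◁[ x ]_) a a
    ◁[]-acyclic-top {x} dim-x cycle = no-step (head⁺ (proj₂ (rotate⁺ (map⁺ through-x cycle))))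
      where
      through-x : ∀ {a b} → a ◁[ x ] b → ∃ λ c → (a ≺⁻ c × c ≡ x) × (c ≡ x × b ≺⁺ c)
      through-x (c , c≤x , dim-c , a≺⁻c , b≺⁺c) with refl ← ≤∧dim≡⇒≡ c≤x (trans dim-c (sym dim-x)) =
        c , (a≺⁻c , refl) , (refl , b≺⁺c)
      no-step : ∀ {c} → ¬ ∃ λ c' → ∃ λ b → (c ≡ x × b ≺⁺ c) × (b ≺⁻ c' × c' ≡ x)
      no-step (_ , _ , (refl , b≺⁺x) , (b≺⁻x , refl)) = not-both b≺⁻x b≺⁺x

    ◁[]-acyclic-codim1 : ∀ {x a} → dim x ≡ suc (suc k) → ¬ TransClosure (_◁[ x ]_) a a
    ◁[]-acyclic-codim1 {x} dim-x cycle =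
      Feeds-acyclic x (map⁺ feeds (proj₂ (rotate⁺ (map⁺ through-face cycle))))
      where
      through-face : ∀ {a b} → a ◁[ x ] b → ∃ λ c → (a ≺⁻ c × c ≺ x) × (c ≺ x × b ≺⁺ c)
      through-face (c , c≤x , dim-c , a≺⁻c , b≺⁺c) =
        c , (a≺⁻c , c≺x) , (c≺x , b≺⁺c)
        where
        c≺x : c ≺ x
        c≺x = ≤∧dim+1⇒≺ c≤x (trans dim-x (cong suc (sym dim-c)))
      feeds : ∀ {c c'} → (∃ λ b → (c ≺ x × b ≺⁺ c) × (b ≺⁻ c' × c' ≺ x)) → Feeds x c c'
      feeds (b , (inj₁ c≺⁻x , b≺⁺c) , (b≺⁻c' , _))    = c≺⁻x , b , b≺⁺c , b≺⁻c'
      feeds (b , (inj₂ c≺⁺x , b≺⁺c) , (b≺⁻c' , c'≺x)) = ⊥-elim (γγ-not-in-δ-of-face b≺⁺c c≺⁺x b≺⁻c' c'≺x)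

    module Descend {x g : Fin n} (g≺⁺x : g ≺⁺ x) (codim : ∀ {y} → y ≺ x → suc k < dim y) where

      ReducesBelow : Fin n → Set
      ReducesBelow y = ∀ {c} → c ≤ y → dim c ≡ suc k → Reduces (_◁[ g ]_) c

      reducesBelow-output : ReducesBelow g
      reducesBelow-output c≤g dim-c a≺⁻c b≺⁺c = [ _ , c≤g , dim-c , a≺⁻c , b≺⁺c ]

      reducesBelow-input-of-input : ∀ {y} → y ≺⁻ x → (∀ {y'} → Feeds x y' y → ReducesBelow y') →
                                    ∀ {e} → e ≺⁻ y → ReducesBelow e
      reducesBelow-input-of-input y≺⁻x earlier-reduce e≺⁻y c≤e with thin-in⁻ e≺⁻y y≺⁻x
      ... | inj₁ (g' , e≺⁻g' , g'≺⁺x) with refl ← γ-unique g'≺⁺x g≺⁺x =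
        reducesBelow-output (≤-≺-trans c≤e (inj₁ e≺⁻g'))
      ... | inj₂ (y' , e≺⁺y' , y'≺⁻x) =
        earlier-reduce (y'≺⁻x , _ , e≺⁺y' , e≺⁻y) (≤-≺-trans c≤e (inj₂ e≺⁺y'))

      reducesBelow-input : ∀ {y} → Acc (Feeds x) y → y ≺⁻ x → ReducesBelow y
      reducesBelow-input {y} (acc earlier) y≺⁻x {c} c≤y dim-c =
        [ (λ c≺⁺y → reduces-output (λ e≺⁻y → below-input e≺⁻y ε (same-dim e≺⁻y c≺⁺y)) c≺⁺y)
        , (λ { (e , e≺⁻y , c≤e) → below-input e≺⁻y c≤e dim-c })
        ]′ (≤-output⊎≤-input c≤y (subst (_< dim y) (sym dim-c) (codim (inj₁ y≺⁻x))))
        where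
        below-input : ∀ {e} → e ≺⁻ y → ReducesBelow e
        below-input = reducesBelow-input-of-input y≺⁻x
          (λ y'⇀y → reducesBelow-input (earlier y'⇀y) (proj₁ y'⇀y))
        same-dim : ∀ {e} → e ≺⁻ y → c ≺⁺ y → dim e ≡ suc k
        same-dim e≺⁻y c≺⁺y = trans (≺-same-dim (inj₁ e≺⁻y) (inj₂ c≺⁺y)) dim-c

      ◁[x]⇒◁[g]⁺ : ∀ {a b} → a ◁[ x ] b → TransClosure (_◁[ g ]_) a b
      ◁[x]⇒◁[g]⁺ (c , c≤x , dim-c , a≺⁻c , b≺⁺c)
        with ≤-output⊎≤-input c≤x (subst (_< dim x) (sym dim-c)
                                    (<-trans (codim (inj₂ g≺⁺x)) (≺⇒dim< (inj₂ g≺⁺x))))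
      ... | inj₁ c≺⁺x with refl ← γ-unique c≺⁺x g≺⁺x = reducesBelow-output ε dim-c a≺⁻c b≺⁺c
      ... | inj₂ (y , y≺⁻x , c≤y) =
        reducesBelow-input (Feeds-wellFounded x y) y≺⁻x c≤y dim-c a≺⁻c b≺⁺c

    ◁[]-acyclic : ∀ d {x a} → dim x ≡ d + suc k → ¬ TransClosure (_◁[ x ]_) a a
    ◁[]-acyclic zero                dim-x = ◁[]-acyclic-top dim-x
    ◁[]-acyclic (suc zero)          dim-x = ◁[]-acyclic-codim1 dim-x
    ◁[]-acyclic (suc (suc d)) {x} dim-x cycle =
      ◁[]-acyclic (suc d) (≺-dim-pred (inj₂ g≺⁺x) dim-x)
        (concatMap⁺ (Descend.◁[x]⇒◁[g]⁺ g≺⁺x codim) cycle)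
      where
      g≺⁺x : proj₁ (γ-exists x _) ≺⁺ x
      g≺⁺x = proj₂ (γ-exists x (subst (1 ℕ.≤_) (sym dim-x) (s≤s z≤n)))
      codim : ∀ {y} → y ≺ x → suc k < dim y
      codim y≺x = subst (suc k <_) (sym (≺-dim-pred y≺x dim-x)) (s≤s (m≤n+m (suc k) d))

    ◁⁺-acyclic : ∀ {a : C k} → ¬ TransClosure _◁⁺_ a a
    ◁⁺-acyclic {a} cycle =
      ◁[]-acyclic (dim t ∸ suc k) (sym (m∸n+n≡m (k<dim-t (head⁺ cycle))))
        (map⁺ (λ {u} {v} → below-t {u} {v}) cycle)
      where
      t : Fin n
      t = proj₁ greatest
      below-t : _◁⁺_ {k} =[ proj₁ ]⇒ _◁[ t ]_
      below-t (c , dim-c , a≺⁻c , b≺⁺c) = c , proj₂ greatest c , dim-c , a≺⁻c , b≺⁺c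
      k<dim-t : ∃ (a ◁⁺_) → suc k ℕ.≤ dim t
      k<dim-t (_ , c , dim-c , _) = subst (ℕ._≤ dim t) dim-c (≤-dim (proj₂ greatest c))

mainTheorem7 : ∀ {n : ℕ} (P : POP n) → IsDendriticFaceComplex P →
    ∀ (k : ℕ) → IsStrictPartialOrder (_≡_ {A = POP.C P k}) (POP._<⁺_ P)
mainTheorem7 P D k = acyclic⇒isStrictPartialOrder (DendriticFaceComplex.◁⁺-acyclic P D k)
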